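{- Let $G$ be a $P_8$-free chordal graph, $A\subseteq RN(G)$, $C$ an irredundant component of $G$, $H=G[C]$, and $T(H)$, $X_1,\dots,X_p$, $X$, $Y$, $F$ as defined in the context. Then a set $D\subseteq C$ dominates $C\setminus(X\cup Y)$ if and only if $D$ dominates $F$.
   Context: All graphs are finite, simple and undirected. $N(x)$, $N[x]$ are open and closed neighbourhoods; $N[X]=\bigcup_{x\in X}N[x]$, $N(X)=N[X]\setminus X$; $D$ dominates $X$ if $X\subseteq N[D]$. A vertex $x$ is irredundant if $N[x]$ is inclusion-minimal in $\{N[y]:y\in V(G)\}$, with the convention that among several vertices having the same inclusion-minimal closed neighbourhood exactly one (fixed) is declared irredundant; others are redundant. $IR(G)$, $RN(G)$ are the irredundant and redundant vertex sets; an irredundant component is the vertex set of a connected component of $G[IR(G)]$. For $D\subseteq V(G)$, $x\in D$, a private neighbour of $x$ w.r.t. $D$ is $u$ with $N[u]\cap D=\{x\}$; $Priv_{IR}(D,x)$ is the set of those in $IR(G)$. For $A\subseteq RN(G)$, $B(A)$ is the set of $a\in A$ having an element of $Priv_{IR}(A,a)$ in some irredundant component contained in $N(A)$, and $R(A)=A\setminus B(A)$. Here $H=G[C]$ is a connected $P_4$-free chordal graph, and $T(H)$ is a fixed rooted tree on $C$ such that two vertices are adjacent in $H$ iff one is an ancestor of the other; it is viewed as a poset with $x<y$ meaning $x$ is a proper ancestor of $y$ (the root $r$ is the minimum, leaves are the maximal elements). Let $x_1,\dots,x_p$ be the elements of $R(A)$ having a private neighbour w.r.t. $A$ in $C$,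 $X_j=Priv_{IR}(A,x_j)$, $X=X_1\cup\dots\cup X_p$, $Y=(N(A)\cap C)\setminus X$, and let $F$ be the set of maximal elements (in $T(H)$) of $C\setminus(X\cup Y)$. $P_k$-free means no induced path on $k$ vertices; chordal means no induced cycle of length at least four. -}

module Defs where

open import Data.Nat using (ℕ; suc; zero)
open import Data.Fin using (Fin; toℕ) renaming (_≤_ to _≤ᶠ_)
open import Data.Bool using (Bool; true; false; T)
open import Data.Product using (Σ; ∃; ∃-syntax; _×_; _,_)
open import Data.Sum using (_⊎_)
open import Relation.Nullary using (¬_)
open import Relation.Binary.PropositionalEquality using (_≡_; _≢_)
open import Function.Definitions using (Injective)
open import Function.Bundles using (_⇔_)

record Graph : Set where
  field
    n      : ℕ
    adj    : Fin n → Fin n → Bool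
    sym    : ∀ x y → adj x y ≡ adj y x
    irrefl : ∀ x → adj x x ≡ false

module _ (G : Graph) where
  open Graph G

  V : Set
  V = Fin n

  VSet : Set
  VSet = V → Bool

  _∈_ : V → VSet → Set
  x ∈ S = T (S x)

  E : V → V → Set
  E x y = T (adj x y)

  NC : V → V → Set
  NC x y = y ≡ x ⊎ E x y

  NClosedSet : VSet → V → Set
  NClosedSet A z = ∃[ a ] (a ∈ A × NC a z)

  NOpenSet : VSet → V → Set
  NOpenSet A z = NClosedSet A z × ¬ (z ∈ A)

  Dominates : VSet → (V → Set) → Set
  Dominates D P = ∀ x → P x → ∃[ d ] (d ∈ D × NC d x)

  NMinimal : V → Set
  NMinimal x = ∀ y → (∀ z → NC y z → NC x z) → ∀ z → NC x z → NC y z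

  -- irredundant: N[x] minimal, and x is the fixed representative
  -- (the one of least index) among vertices with the same closed nbhd
  IR : V → Set
  IR x = NMinimal x × (∀ y → (∀ z → NC x z ⇔ NC y z) → x ≤ᶠ y)

  RN : V → Set
  RN x = ¬ IR x

  Priv : VSet → V → V → Set
  Priv D x u = NC u x × (∀ d → d ∈ D → NC u d → d ≡ x)

  PrivIR : VSet → V → V → Set
  PrivIR D x u = Priv D x u × IR u

  data Reach (K : VSet) (x : V) : V → Set where
    here : Reach K x x
    step : ∀ {y z} → Reach K x y → E y z → z ∈ K → Reach K x z

  IRComponent : VSet → Set
  IRComponent K =
    (∀ x → x ∈ K → IR x)
    × (∃[ x ] (x ∈ K))
    × (∀ x y → x ∈ K → y ∈ K → Reach K x y)
    × (∀ x y → x ∈ K → IR y → E x y → y ∈ K)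

  BSet : VSet → V → Set
  BSet A a = a ∈ A × ∃[ u ] (PrivIR A a u × Σ VSet (λ K →
               IRComponent K × u ∈ K × (∀ z → z ∈ K → NOpenSet A z)))

  RSet : VSet → V → Set
  RSet A a = a ∈ A × ¬ BSet A a

  -- X = X_1 ∪ ... ∪ X_p, where x_1..x_p are the elements of R(A) having
  -- a private neighbour w.r.t. A in C, and X_j = Priv_IR(A, x_j)
  XSet : VSet → VSet → V → Set
  XSet A C u = ∃[ x ] (RSet A x × (∃[ w ] (w ∈ C × Priv A x w)) × PrivIR A x u)

  YSet : VSet → VSet → V → Set
  YSet A C u = NOpenSet A u × u ∈ C × ¬ XSet A C u

  SSet : VSet → VSet → V → Set
  SSet A C u = u ∈ C × ¬ XSet A C u × ¬ YSet A C u

  -- F: maximal elements of C \ (X ∪ Y) in the poset T(H);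
  -- anc x y means x is a proper ancestor of y (x < y)
  FSet : VSet → VSet → (V → V → Bool) → V → Set
  FSet A C anc u = SSet A C u × (∀ v → SSet A C v → ¬ T (anc u v))

  -- anc is the proper-ancestor relation of a rooted tree on C such that
  -- two vertices of C are adjacent iff one is an ancestor of the other
  IsTreeModel : VSet → (V → V → Bool) → Set
  IsTreeModel C anc =
    (∀ x y → T (anc x y) → x ∈ C × y ∈ C)
    × (∀ x → ¬ T (anc x x))
    × (∀ x y z → T (anc x y) → T (anc y z) → T (anc x z))
    × (∀ x y z → T (anc x z) → T (anc y z) → x ≡ y ⊎ T (anc x y) ⊎ T (anc y x))
    × (∃[ r ] (r ∈ C × (∀ x → x ∈ C → x ≢ r → T (anc r x))))
    × (∀ x y → x ∈ C → y ∈ C → (E x y ⇔ (T (anc x y) ⊎ T (anc y x))))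

  InducedBy : (k : ℕ) → (Fin k → Fin k → Set) → (Fin k → V) → Set
  InducedBy k R f = Injective _≡_ _≡_ f × (∀ i j → E (f i) (f j) ⇔ R i j)

  PathAdj : {k : ℕ} → Fin k → Fin k → Set
  PathAdj i j = suc (toℕ i) ≡ toℕ j ⊎ suc (toℕ j) ≡ toℕ i

  CycleAdj : (k : ℕ) → Fin k → Fin k → Set
  CycleAdj k i j = PathAdj i j
    ⊎ (toℕ i ≡ 0 × suc (toℕ j) ≡ k)
    ⊎ (toℕ j ≡ 0 × suc (toℕ i) ≡ k)

  PFree : ℕ → Set
  PFree k = ¬ (Σ (Fin k → V) (InducedBy k PathAdj))

  Chordal : Set
  Chordal = ∀ k → 4 Data.Nat.≤ k → ¬ (Σ (Fin k → V) (InducedBy k (CycleAdj k)))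

module Submission where

-- F consists of the maximal elements of S = C \ (X ∪ Y) in the
-- ancestor order of the tree model T(H), so F ⊆ S and one direction is
-- immediate.  For the other, let D ⊆ C dominate F and take u ∈ S.  Since
-- Fin n is finite, the proper-ancestor order is Noetherian, so u lies below
-- some maximal element v of S, i.e. some v ∈ F with u ≼ v.  In a tree model
-- closed neighbourhoods only grow towards the root (N[v] ⊆ N[u] for u ≼ v),
-- hence the vertex of D dominating v also dominates u.
--
-- Constructively we cannot decide membership in S (it quantifies over
-- vertex sets), so "pick a maximal element above u" is phrased as a
-- Noetherian induction towards a decidable goal: "u ∈ N[D]".

open import Defs
open import Data.Bool using (Bool; T)
open import Data.Nat using (ℕ)
open import Data.Fin using (Fin)
open import Data.Fin.Induction using (spo-noetherian)
open import Data.Fin.Properties using (any?; _≟_)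
open import Data.Product using (_,_; proj₁; proj₂)
open import Data.Sum using (_⊎_; inj₁; inj₂)
open import Data.Empty using (⊥; ⊥-elim)
open import Function.Base using (flip)
open import Function.Bundles using (_⇔_; mk⇔; Equivalence)
open import Induction.WellFounded using (Acc; acc)
open import Level using (Level)
open import Relation.Binary.Core using (Rel)
open import Relation.Binary.Structures using (IsStrictPartialOrder)
open import Relation.Binary.PropositionalEquality
  using (_≡_; refl; isEquivalence; resp₂)
open import Relation.Nullary using (¬_; Dec; yes; no)
open import Relation.Nullary.Decidable using (T?; _×-dec_; _⊎-dec_)

-- Finiteness makes the
-- order Noetherian (spo-noetherian); decidability of Q lets us argue by
-- contradiction instead of choosing a maximal element, which would require
-- P to be decidable.
module _ {n : ℕ} {r : Level} {_⊏_ : Rel (Fin n) r}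
         (isSPO : IsStrictPartialOrder _≡_ _⊏_) where

  open IsStrictPartialOrder isSPO using (trans)

  _≼_ : Fin n → Fin n → Set r
  u ≼ v = u ≡ v ⊎ u ⊏ v

  ≼-⊏-trans : ∀ {u v w} → u ≼ v → v ⊏ w → u ≼ w
  ≼-⊏-trans (inj₁ refl) v⊏w = inj₂ v⊏w
  ≼-⊏-trans (inj₂ u⊏v) v⊏w = inj₂ (trans u⊏v v⊏w)

  maximal-above : {p q : Level} {P : Fin n → Set p} {Q : Set q} → Dec Q →
    ∀ u → P u → (∀ v → u ≼ v → P v → (∀ w → P w → ¬ v ⊏ w) → Q) → Q
  maximal-above (yes q) _ _ _ = q
  maximal-above {P = P} (no ¬q) u Pu atMaximal =
    ⊥-elim (climb u (spo-noetherian isSPO u) (inj₁ refl) Pu)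
    where
    -- each element of P above u is refuted: were it maximal, Q would hold;
    -- otherwise refute the strictly larger element of P above it
    climb : ∀ v → Acc (flip _⊏_) v → u ≼ v → P v → ⊥
    climb v (acc larger) u≼v Pv =
      ¬q (atMaximal v u≼v Pv (λ w Pw v⊏w →
            climb w (larger v⊏w) (≼-⊏-trans u≼v v⊏w) Pw))

module _ (G : Graph) where
  open Graph G using (adj)

  private
    _∈ᴳ_ : V G → VSet G → Set
    _∈ᴳ_ = _∈_ G

  inClosedNbhd? : (D : VSet G) (u : V G) → Dec (NClosedSet G D u)
  inClosedNbhd? D u =
    any? (λ d → T? (D d) ×-dec ((u ≟ d) ⊎-dec T? (adj d u)))

  module _ {C : VSet G} {anc : V G → V G → Bool} where

    Anc : V G → V G → Set
    Anc x y = T (anc x y)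

    ancestors-isStrictPartialOrder : IsTreeModel G C anc →
      IsStrictPartialOrder _≡_ Anc
    ancestors-isStrictPartialOrder (_ , irrefl , trans , _) = record
      { isEquivalence = isEquivalence
      ; irrefl        = λ { {x} refl → irrefl x }
      ; trans         = λ {x} {y} {z} → trans x y z
      ; <-resp-≈      = resp₂ Anc
      }

    comparable⇒inClosedNbhd : IsTreeModel G C anc → ∀ {d u} →
      d ∈ᴳ C → u ∈ᴳ C → u ≡ d ⊎ Anc d u ⊎ Anc u d → NC G d u
    comparable⇒inClosedNbhd _ _ _ (inj₁ u≡d) = inj₁ u≡d
    comparable⇒inClosedNbhd (_ , _ , _ , _ , _ , adjacency) dC uC
                            (inj₂ comparable) =
      inj₂ (Equivalence.from (adjacency _ _ dC uC) comparable)

    dominates-ancestors : IsTreeModel G C anc → ∀ {d u v} → d ∈ᴳ C →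
      u ≡ v ⊎ Anc u v → NC G d v → NC G d u
    dominates-ancestors _ _ (inj₁ refl) d∼v = d∼v
    dominates-ancestors tree@(inC , _ , trans , meet , _ , adjacency)
                        {d} {u} {v} dC (inj₂ u<v) d∼v =
      comparable⇒inClosedNbhd tree dC uC (comparable d∼v)
      where
      uC : u ∈ᴳ C
      uC = proj₁ (inC u v u<v)
      vC : v ∈ᴳ C
      vC = proj₂ (inC u v u<v)
      -- d ∈ N[v] and u < v force d and u to be comparable: the ancestors
      -- of v form a chain, and descendants of v are descendants of u
      comparable : NC G d v → u ≡ d ⊎ Anc d u ⊎ Anc u d
      comparable (inj₁ refl) = inj₂ (inj₂ u<v)
      comparable (inj₂ d∼v) with Equivalence.to (adjacency d v dC vC) d∼v
      ... | inj₂ v<d = inj₂ (inj₂ (trans u v d u<v v<d))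
      ... | inj₁ d<v with meet d u v d<v u<v
      ...   | inj₁ refl = inj₁ refl
      ...   | inj₂ ordered = inj₂ ordered

lemma13 : (G : Graph) → PFree G 8 → Chordal G
    → (A : VSet G) → (∀ a → _∈_ G a A → RN G a)
    → (C : VSet G) → IRComponent G C
    → (anc : V G → V G → Bool) → IsTreeModel G C anc
    → (D : VSet G) → (∀ d → _∈_ G d D → _∈_ G d C)
    → (Dominates G D (SSet G A C) ⇔ Dominates G D (FSet G A C anc))
lemma13 G _ _ A _ C _ anc tree D D⊆C = mk⇔ restrictToF extendFromF
  where
  restrictToF : Dominates G D (SSet G A C) → Dominates G D (FSet G A C anc)
  restrictToF domS u (Su , _) = domS u Su

  extendFromF : Dominates G D (FSet G A C anc) → Dominates G D (SSet G A C)
  extendFromF domF u Su =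
    maximal-above (ancestors-isStrictPartialOrder G tree)
      (inClosedNbhd? G D u) u Su
      λ v u≼v Sv maximal →
        let (d , d∈D , d∼v) = domF v (Sv , maximal)
        in d , d∈D , dominates-ancestors G tree (D⊆C d d∈D) u≼v d∼v
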